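{- Let $m$ be an odd number not divisible by $3$. The total number of points lying in non-trivial extreme cycles for the digits $\{0,m\}$ (counted over all non-trivial extreme cycles) is at most $\min_{n\ge 0}\left\{2^n\left\lceil\frac{m}{3\cdot 4^n}\right\rceil\right\}$.
   Context: For odd $m$, a finite set $\{x_0,\dots,x_{r-1}\}\subset\mathbb{R}$ is an extreme cycle for the digits $\{0,m\}$ if there exist $l_0,\dots,l_{r-1}\in\{0,m\}$ with $x_{k+1}=(x_k+l_k)/4$ for $0\le k\le r-2$, $x_0=(x_{r-1}+l_{r-1})/4$, and $\left|\frac{1+e^{2\pi i\cdot 2x_k}}{2}\right|=1$ for all $k$. The trivial extreme cycle is $\{0\}$. $\lceil x\rceil$ is the smallest integer $\ge x$; $n$ ranges over non-negative integers.
   Formalization: The points of the extreme cycles for the digits $\{0,m\}$ are rational numbers rather than real numbers. -}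

module Defs where

open import Data.Nat using (ℕ; suc)
open import Data.Integer using (ℤ; +_)
open import Data.Rational using (ℚ; _/_; _+_; _*_; 0ℚ)
open import Data.Fin using (Fin; zero; suc; inject₁; fromℕ)
open import Data.Product using (Σ; ∃; _×_)
open import Data.Sum using (_⊎_)
open import Relation.Binary.PropositionalEquality using (_≡_; _≢_)

ℚ[_] : ℕ → ℚ
ℚ[ m ] = (+ m) / 1

τ : ℚ → ℚ → ℚ
τ l x = (x + l) * ((+ 1) / 4)

-- Extreme condition |(1 + e^{2πi·2x})/2| = 1, which is |cos(2πx)| = 1,
-- i.e. 2x ∈ ℤ.
IsExtremePoint : ℚ → Set
IsExtremePoint x = Σ ℤ λ k → ℚ[ 2 ] * x ≡ k / 1

-- An extreme cycle for digits {0,m} of length r = suc s, given as the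
-- enumeration x_0,…,x_s of its points together with the digits l_0,…,l_s.
record ExtremeCycle (m : ℕ) (s : ℕ) : Set where
  field
    x       : Fin (suc s) → ℚ
    l       : Fin (suc s) → ℚ
    digit   : ∀ k → (l k ≡ 0ℚ) ⊎ (l k ≡ ℚ[ m ])
    step    : ∀ (k : Fin s) → x (suc k) ≡ τ (l (inject₁ k)) (x (inject₁ k))
    close   : x zero ≡ τ (l (fromℕ s)) (x (fromℕ s))
    extreme : ∀ k → IsExtremePoint (x k)

NonTrivial : ∀ {m s} → ExtremeCycle m s → Set
NonTrivial C = ∃ λ k → ExtremeCycle.x C k ≢ 0ℚ

InNonTrivialExtremeCycle : ℕ → ℚ → Set
InNonTrivialExtremeCycle m y =
  Σ ℕ λ s → Σ (ExtremeCycle m s) λ C →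
    NonTrivial C × (∃ λ k → ExtremeCycle.x C k ≡ y)

open import Data.Nat as ℕ using ()
open import Data.Nat.Properties using (m*n≢0; m^n≢0)

m/3·4^n : ℕ → ℕ → ℚ
m/3·4^n m n = _/_ (+ m) (3 ℕ.* 4 ℕ.^ n) {{m*n≢0 3 (4 ℕ.^ n) {{_}} {{m^n≢0 4 n}}}}

{-# OPTIONS --safe #-}
-- Doubling a point x of an extreme cycle gives an integer z = 2x, and the cycle
-- relation becomes 4 z_k = z_(k-1) + 2 l_(k-1) with l ∈ {0, m}.  At a minimum of z
-- over the cycle this forces z ≥ 0, at a maximum 3z ≤ 2m, and z_(k-1) = 4 z_k - 2 l_(k-1)
-- is even; so every point is a natural number b with 3b ≤ m, hence 3b < m as 3 ∤ m.
-- Going n steps back along the cycle gives 4^n b = c + d with c again a point and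
-- d one of the 2^n sums Σ_(i<n) ε_i 4^i m, ε_i ∈ {0,1}.  So 3·4^n b lies in
-- [3d, 3d + m), which contains at most ⌈m/(3·4^n)⌉ multiples of 3·4^n.

module Submission where

open import Defs
open import Data.Nat as ℕ using (ℕ; zero; suc; _+_; _*_; _^_; _∸_; _≤_; _<_; z≤n; s≤s)
import Data.Nat.Properties as ℕ
open import Data.Nat.Divisibility using (_∣_; divides; ∣m+n∣m⇒∣n; m∣m*n; ∣-trans)
open import Data.Nat.Coprimality using (1-coprimeTo) renaming (sym to coprime-sym)
open import Data.Integer as ℤ using (ℤ; +_; -[1+_])
import Data.Integer.Properties as ℤ
open import Data.Integer.DivMod using ([n/d]*d≤n)
open import Data.Integer.GCD using (gcd)
open import Data.Rational as ℚ using (ℚ; mkℚ; _/_; 1ℚ; floor; ceiling)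
import Data.Rational.Properties as ℚ
open import Data.Rational.Solver using (module +-*-Solver)
open import Data.Fin using (Fin; zero; suc; inject₁; fromℕ; toℕ; lower₁)
open import Data.Fin.Properties using (toℕ-injective; toℕ-fromℕ; inject₁-lower₁)
open import Data.List using (List; []; _∷_; [_]; _++_; length; map; upTo; allFin; cartesianProductWith)
open import Data.List.Properties using (length-++; length-map; length-upTo)
open import Data.List.Membership.Propositional using (_∈_)
open import Data.List.Membership.Propositional.Properties
  using (∈-++⁺ˡ; ∈-++⁺ʳ; ∈-++⁻; ∈-map⁺; ∈-∃++; ∈-upTo⁺; ∈-allFin; ∈-cartesianProductWith⁺)
open import Data.List.Relation.Binary.Subset.Propositional using (_⊆_)
open import Data.List.Relation.Unary.Any using (here; there)
open import Data.List.Relation.Unary.All as All using (All)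
import Data.List.Relation.Unary.All.Properties as All
open import Data.List.Relation.Unary.AllPairs using (_∷_)
open import Data.List.Relation.Unary.Unique.Propositional using (Unique)
import Data.List.Relation.Unary.Unique.Propositional.Properties as Unique
import Data.List.Extrema as Extrema
open import Data.Product using (Σ; ∃; ∃₂; _×_; _,_; proj₁; proj₂)
open import Data.Sum using (_⊎_; inj₁; inj₂)
open import Data.Empty using (⊥-elim)
open import Relation.Nullary using (¬_; yes; no)
open import Function using (_∘_)
open import Relation.Binary.PropositionalEquality
  using (_≡_; refl; sym; trans; cong; cong₂; subst; module ≡-Reasoning)

fromℤ : ℤ → ℚ
fromℤ i = i / 1

fromℤ-canonical : ∀ i → fromℤ i ≡ mkℚ i 0 (coprime-sym (1-coprimeTo ℤ.∣ i ∣))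
fromℤ-canonical i = ℚ.↥p/↧p≡p (mkℚ i 0 (coprime-sym (1-coprimeTo ℤ.∣ i ∣)))

fromℤ-injective : ∀ {i j} → fromℤ i ≡ fromℤ j → i ≡ j
fromℤ-injective {i} {j} eq = begin
  i                ≡⟨ cong ℚ.↥_ (fromℤ-canonical i) ⟨
  ℚ.↥ (fromℤ i)    ≡⟨ cong ℚ.↥_ eq ⟩
  ℚ.↥ (fromℤ j)    ≡⟨ cong ℚ.↥_ (fromℤ-canonical j) ⟩
  j                ∎
  where open ≡-Reasoning

fromℤ-+ : ∀ i j → fromℤ (i ℤ.+ j) ≡ fromℤ i ℚ.+ fromℤ j
fromℤ-+ i j rewrite fromℤ-canonical i | fromℤ-canonical j =
  sym (ℚ./-cong {i ℤ.* + 1 ℤ.+ j ℤ.* + 1} (cong₂ ℤ._+_ (ℤ.*-identityʳ i) (ℤ.*-identityʳ j)) refl)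

fromℤ-* : ∀ i j → fromℤ (i ℤ.* j) ≡ fromℤ i ℚ.* fromℤ j
fromℤ-* i j rewrite fromℤ-canonical i | fromℤ-canonical j = sym (ℚ./-cong {i ℤ.* j} refl refl)

ℚ[]-injective : ∀ {a b} → ℚ[ a ] ≡ ℚ[ b ] → a ≡ b
ℚ[]-injective eq = ℤ.+-injective (fromℤ-injective eq)

*-distribˡ-τ : ∀ c l x → c ℚ.* τ l x ≡ τ (c ℚ.* l) (c ℚ.* x)
*-distribˡ-τ c l x =
  solve 4 (λ c l x q → c :* ((x :+ l) :* q) := (c :* x :+ c :* l) :* q) refl c l x (+ 1 / 4)
  where open +-*-Solver

4*τ : ∀ l x → ℚ[ 4 ] ℚ.* τ l x ≡ x ℚ.+ l
4*τ l x = begin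
  ℚ[ 4 ] ℚ.* τ l x              ≡⟨ solve 4 (λ c l x q → c :* ((x :+ l) :* q) := (x :+ l) :* (c :* q))
                                            refl ℚ[ 4 ] l x (+ 1 / 4) ⟩
  -- ℚ[ 4 ] ℚ.* (+ 1 / 4) computes to 1ℚ
  (x ℚ.+ l) ℚ.* 1ℚ              ≡⟨ ℚ.*-identityʳ (x ℚ.+ l) ⟩
  x ℚ.+ l                        ∎
  where open ≡-Reasoning; open +-*-Solver

τ-fromℤ : ∀ i j d → fromℤ j ≡ τ (fromℤ d) (fromℤ i) → + 4 ℤ.* j ≡ i ℤ.+ d
τ-fromℤ i j d eq = fromℤ-injective (begin
  fromℤ (+ 4 ℤ.* j)                 ≡⟨ fromℤ-* (+ 4) j ⟩
  ℚ[ 4 ] ℚ.* fromℤ j                ≡⟨ cong (ℚ[ 4 ] ℚ.*_) eq ⟩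
  ℚ[ 4 ] ℚ.* τ (fromℤ d) (fromℤ i)  ≡⟨ 4*τ (fromℤ d) (fromℤ i) ⟩
  fromℤ i ℚ.+ fromℤ d               ≡⟨ fromℤ-+ i d ⟨
  fromℤ (i ℤ.+ d)                   ∎)
  where open ≡-Reasoning

½*2*p≡p : ∀ p → + 1 / 2 ℚ.* (ℚ[ 2 ] ℚ.* p) ≡ p
-- + 1 / 2 ℚ.* ℚ[ 2 ] computes to 1ℚ
½*2*p≡p p = trans (sym (ℚ.*-assoc (+ 1 / 2) ℚ[ 2 ] p)) (ℚ.*-identityˡ p)

2*-injective : ∀ {p q} → ℚ[ 2 ] ℚ.* p ≡ ℚ[ 2 ] ℚ.* q → p ≡ q
2*-injective {p} {q} eq = begin
  p                                ≡⟨ ½*2*p≡p p ⟨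
  + 1 / 2 ℚ.* (ℚ[ 2 ] ℚ.* p)       ≡⟨ cong (+ 1 / 2 ℚ.*_) eq ⟩
  + 1 / 2 ℚ.* (ℚ[ 2 ] ℚ.* q)       ≡⟨ ½*2*p≡p q ⟩
  q                                ∎
  where open ≡-Reasoning

⌊⌋*↧≤↥ : ∀ p → floor p ℤ.* ℚ.↧ p ℤ.≤ ℚ.↥ p
⌊⌋*↧≤↥ p@record{} = [n/d]*d≤n (ℚ.↥ p) (ℚ.↧ p)

↥≤⌈⌉*↧ : ∀ p → ℚ.↥ p ℤ.≤ ⌈ p ⌉ ℤ.* ℚ.↧ p
↥≤⌈⌉*↧ p@record{} = begin
  ℚ.↥ p                             ≡⟨ ℤ.neg-involutive (ℚ.↥ p) ⟨
  ℤ.- ℤ.- ℚ.↥ p                     ≡⟨ cong ℤ.-_ (ℚ.↥-neg p) ⟨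
  ℤ.- ℚ.↥ (ℚ.- p)                   ≤⟨ ℤ.neg-mono-≤ ⌊-p⌋*↧≤↥ ⟩
  ℤ.- (floor (ℚ.- p) ℤ.* ℚ.↧ p)     ≡⟨ ℤ.neg-distribˡ-* (floor (ℚ.- p)) (ℚ.↧ p) ⟩
  ⌈ p ⌉ ℤ.* ℚ.↧ p                   ∎
  where
  open ℤ.≤-Reasoning
  ⌊-p⌋*↧≤↥ : floor (ℚ.- p) ℤ.* ℚ.↧ p ℤ.≤ ℚ.↥ (ℚ.- p)
  ⌊-p⌋*↧≤↥ = subst (λ d → floor (ℚ.- p) ℤ.* d ℤ.≤ ℚ.↥ (ℚ.- p)) (ℚ.↧-neg p) (⌊⌋*↧≤↥ (ℚ.- p))

⌈m/K⌉-natural : ∀ m K .{{_ : ℕ.NonZero K}} → ∃ λ C → ⌈ + m / K ⌉ ≡ + C × m ≤ K * C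
⌈m/K⌉-natural m K =
  ℤ.∣ ⌈p⌉ ∣ , sym +∣⌈p⌉∣≡⌈p⌉ , ℕ.≤-trans (ℤ.drop‿+≤+ m≤∣⌈p⌉∣*K) (ℕ.≤-reflexive (ℕ.*-comm ℤ.∣ ⌈p⌉ ∣ K))
  where
  open ℤ.≤-Reasoning
  p = + m / K
  ⌈p⌉ = ⌈ p ⌉
  g = gcd (+ m) (+ K)
  m≤⌈p⌉*K : + m ℤ.≤ ⌈p⌉ ℤ.* + K
  m≤⌈p⌉*K = begin
    + m                          ≡⟨ ℚ.↥-/ (+ m) K ⟨
    ℚ.↥ p ℤ.* g                  ≤⟨ ℤ.*-monoʳ-≤-nonNeg g (↥≤⌈⌉*↧ p) ⟩
    ⌈p⌉ ℤ.* ℚ.↧ p ℤ.* g          ≡⟨ ℤ.*-assoc ⌈p⌉ (ℚ.↧ p) g ⟩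
    ⌈p⌉ ℤ.* (ℚ.↧ p ℤ.* g)        ≡⟨ cong (⌈p⌉ ℤ.*_) (ℚ.↧-/ (+ m) K) ⟩
    ⌈p⌉ ℤ.* + K                  ∎
  instance
    K-positive : ℤ.Positive (+ K)
    K-positive = ℤ.positive (ℤ.+<+ (ℕ.>-nonZero⁻¹ K))
  +∣⌈p⌉∣≡⌈p⌉ : + ℤ.∣ ⌈p⌉ ∣ ≡ ⌈p⌉
  +∣⌈p⌉∣≡⌈p⌉ = ℤ.0≤i⇒+∣i∣≡i (ℤ.*-cancelʳ-≤-pos (+ 0) ⌈p⌉ (+ K) (ℤ.≤-trans (ℤ.+≤+ ℕ.z≤n) m≤⌈p⌉*K))
  m≤∣⌈p⌉∣*K : + m ℤ.≤ + (ℤ.∣ ⌈p⌉ ∣ * K)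
  m≤∣⌈p⌉∣*K = subst (+ m ℤ.≤_) (trans (cong (ℤ._* + K) (sym +∣⌈p⌉∣≡⌈p⌉)) (sym (ℤ.pos-* ℤ.∣ ⌈p⌉ ∣ K))) m≤⌈p⌉*K

i≤4i⇒0≤i : ∀ {i} → i ℤ.≤ + 4 ℤ.* i → + 0 ℤ.≤ i
i≤4i⇒0≤i {+ _}      _            = ℤ.+≤+ z≤n
-- for i = -[1+ n ], 4i = -[1+ 4n + 3 ] lies strictly below i
i≤4i⇒0≤i { -[1+ n ]} (ℤ.-≤- le) = ⊥-elim (ℕ.<-irrefl refl (ℕ.<-≤-trans (ℕ.m<m+n n ℕ.z<s) le))

module _ {s : ℕ} (pred : Fin (suc s) → Fin (suc s)) where

  open Extrema ℤ.≤-totalOrder using (argmin; f[argmin]≤f[xs])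
  open Extrema ℕ.≤-totalOrder using (argmax; f[xs]≤f[argmax])

  pred≤4*⇒0≤ : (z : Fin (suc s) → ℤ) → (∀ k → z (pred k) ℤ.≤ + 4 ℤ.* z k) → ∀ k → + 0 ℤ.≤ z k
  pred≤4*⇒0≤ z z-pred k = ℤ.≤-trans (i≤4i⇒0≤i (ℤ.≤-trans (min≤ (pred k₀)) (z-pred k₀))) (min≤ k)
    where
    k₀ = argmin z zero (allFin (suc s))
    min≤ : ∀ j → z k₀ ℤ.≤ z j
    min≤ j = All.lookup (f[argmin]≤f[xs] {f = z} zero (allFin (suc s))) (∈-allFin j)

  4*≤pred+⇒3*≤ : (n : Fin (suc s) → ℕ) (M : ℕ) → (∀ k → 4 * n k ≤ n (pred k) + M) → ∀ k → 3 * n k ≤ M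
  4*≤pred+⇒3*≤ n M n-pred k = ℕ.≤-trans (ℕ.*-monoʳ-≤ 3 (≤max k))
    -- 4 * n k₀ is n k₀ + 3 * n k₀ by definition of _*_
    (ℕ.+-cancelˡ-≤ (n k₀) _ _ (ℕ.≤-trans (n-pred k₀) (ℕ.+-monoˡ-≤ M (≤max (pred k₀)))))
    where
    k₀ = argmax n zero (allFin (suc s))
    ≤max : ∀ j → n j ≤ n k₀
    ≤max j = All.lookup (f[xs]≤f[argmax] {f = n} zero (allFin (suc s))) (∈-allFin j)

digit-value : ∀ {m q} → q ≡ ℚ.0ℚ ⊎ q ≡ ℚ[ m ] → ∃ λ d → q ≡ ℚ[ d ] × (d ≡ 0 ⊎ d ≡ m)
digit-value     (inj₁ q≡0) = 0 , q≡0 , inj₁ refl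
digit-value {m} (inj₂ q≡m) = m , q≡m , inj₂ refl

module ExtremeCycleArithmetic {m s : ℕ} (C : ExtremeCycle m s) where
  open ExtremeCycle C

  pred : Fin (suc s) → Fin (suc s)
  pred zero    = fromℕ s
  pred (suc k) = inject₁ k

  x≡τ[pred] : ∀ k → x k ≡ τ (l (pred k)) (x (pred k))
  x≡τ[pred] zero    = close
  x≡τ[pred] (suc k) = step k

  pred-surjective : ∀ j → ∃ λ k → pred k ≡ j
  pred-surjective j with s ℕ.≟ toℕ j
  ... | yes s≡j = zero , toℕ-injective (trans (toℕ-fromℕ s) s≡j)
  ... | no  s≢j = suc (lower₁ j s≢j) , inject₁-lower₁ j s≢j

  lℕ : Fin (suc s) → ℕ
  lℕ k = proj₁ (digit-value {m} (digit k))

  l≡ℚ[lℕ] : ∀ k → l k ≡ ℚ[ lℕ k ]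
  l≡ℚ[lℕ] k = proj₁ (proj₂ (digit-value {m} (digit k)))

  lℕ-digit : ∀ k → lℕ k ≡ 0 ⊎ lℕ k ≡ m
  lℕ-digit k = proj₂ (proj₂ (digit-value {m} (digit k)))

  lℕ≤m : ∀ k → lℕ k ≤ m
  lℕ≤m k with lℕ-digit k
  ... | inj₁ l≡0 = subst (_≤ m) (sym l≡0) z≤n
  ... | inj₂ l≡m = ℕ.≤-reflexive l≡m

  z : Fin (suc s) → ℤ
  z k = proj₁ (extreme k)

  2x≡z : ∀ k → ℚ[ 2 ] ℚ.* x k ≡ fromℤ (z k)
  2x≡z k = proj₂ (extreme k)

  4z≡z[pred]+2lℕ : ∀ k → + 4 ℤ.* z k ≡ z (pred k) ℤ.+ + (2 * lℕ (pred k))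
  4z≡z[pred]+2lℕ k = τ-fromℤ (z (pred k)) (z k) (+ (2 * lℕ (pred k))) (begin
    fromℤ (z k)                              ≡⟨ 2x≡z k ⟨
    ℚ[ 2 ] ℚ.* x k                           ≡⟨ cong (ℚ[ 2 ] ℚ.*_) (x≡τ[pred] k) ⟩
    ℚ[ 2 ] ℚ.* τ (l p) (x p)                 ≡⟨ *-distribˡ-τ ℚ[ 2 ] (l p) (x p) ⟩
    τ (ℚ[ 2 ] ℚ.* l p) (ℚ[ 2 ] ℚ.* x p)      ≡⟨ cong₂ τ 2l≡2lℕ (2x≡z p) ⟩
    τ (fromℤ (+ (2 * lℕ p))) (fromℤ (z p))   ∎)
    where
    open ≡-Reasoning
    p = pred k
    2l≡2lℕ : ℚ[ 2 ] ℚ.* l p ≡ fromℤ (+ (2 * lℕ p))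
    2l≡2lℕ = begin
      ℚ[ 2 ] ℚ.* l p          ≡⟨ cong (ℚ[ 2 ] ℚ.*_) (l≡ℚ[lℕ] p) ⟩
      ℚ[ 2 ] ℚ.* ℚ[ lℕ p ]    ≡⟨ fromℤ-* (+ 2) (+ lℕ p) ⟨
      fromℤ (+ 2 ℤ.* + lℕ p)  ≡⟨ cong fromℤ (ℤ.pos-* 2 (lℕ p)) ⟨
      fromℤ (+ (2 * lℕ p))    ∎

  0≤z : ∀ k → + 0 ℤ.≤ z k
  0≤z = pred≤4*⇒0≤ pred z λ k →
    subst (z (pred k) ℤ.≤_) (sym (4z≡z[pred]+2lℕ k)) (ℤ.i≤i+j (z (pred k)) (+ (2 * lℕ (pred k))))

  zℕ : Fin (suc s) → ℕ
  zℕ k = ℤ.∣ z k ∣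

  +zℕ≡z : ∀ k → + zℕ k ≡ z k
  +zℕ≡z k = ℤ.0≤i⇒+∣i∣≡i (0≤z k)

  4zℕ≡zℕ[pred]+2lℕ : ∀ k → 4 * zℕ k ≡ zℕ (pred k) + 2 * lℕ (pred k)
  4zℕ≡zℕ[pred]+2lℕ k = ℤ.+-injective (begin
    + (4 * zℕ k)                           ≡⟨ ℤ.pos-* 4 (zℕ k) ⟩
    + 4 ℤ.* + zℕ k                         ≡⟨ cong (+ 4 ℤ.*_) (+zℕ≡z k) ⟩
    + 4 ℤ.* z k                            ≡⟨ 4z≡z[pred]+2lℕ k ⟩
    z (pred k) ℤ.+ + (2 * lℕ (pred k))     ≡⟨ cong (ℤ._+ + (2 * lℕ (pred k))) (+zℕ≡z (pred k)) ⟨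
    + (zℕ (pred k) + 2 * lℕ (pred k))      ∎)
    where open ≡-Reasoning

  3zℕ≤2m : ∀ k → 3 * zℕ k ≤ 2 * m
  3zℕ≤2m = 4*≤pred+⇒3*≤ pred zℕ (2 * m) λ k →
    subst (_≤ zℕ (pred k) + 2 * m) (sym (4zℕ≡zℕ[pred]+2lℕ k))
      (ℕ.+-monoʳ-≤ (zℕ (pred k)) (ℕ.*-monoʳ-≤ 2 (lℕ≤m (pred k))))

  2∣zℕ : ∀ j → 2 ∣ zℕ j
  2∣zℕ j with pred-surjective j
  ... | k , refl = ∣m+n∣m⇒∣n 2∣2lℕ+zℕ[pred] (m∣m*n (lℕ (pred k)))
    where
    2∣2lℕ+zℕ[pred] : 2 ∣ 2 * lℕ (pred k) + zℕ (pred k)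
    2∣2lℕ+zℕ[pred] = subst (2 ∣_) (trans (4zℕ≡zℕ[pred]+2lℕ k) (ℕ.+-comm (zℕ (pred k)) _))
                      (∣-trans (divides 2 refl) (m∣m*n (zℕ k)))

  xℕ : Fin (suc s) → ℕ
  xℕ j = _∣_.quotient (2∣zℕ j)

  zℕ≡2xℕ : ∀ j → zℕ j ≡ 2 * xℕ j
  zℕ≡2xℕ j = trans (_∣_.equality (2∣zℕ j)) (ℕ.*-comm (xℕ j) 2)

  x≡ℚ[xℕ] : ∀ j → x j ≡ ℚ[ xℕ j ]
  x≡ℚ[xℕ] j = 2*-injective (begin
    ℚ[ 2 ] ℚ.* x j           ≡⟨ 2x≡z j ⟩
    fromℤ (z j)              ≡⟨ cong fromℤ (+zℕ≡z j) ⟨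
    fromℤ (+ zℕ j)           ≡⟨ cong (fromℤ ∘ +_) (zℕ≡2xℕ j) ⟩
    fromℤ (+ (2 * xℕ j))     ≡⟨ cong fromℤ (ℤ.pos-* 2 (xℕ j)) ⟩
    fromℤ (+ 2 ℤ.* + xℕ j)   ≡⟨ fromℤ-* (+ 2) (+ xℕ j) ⟩
    ℚ[ 2 ] ℚ.* ℚ[ xℕ j ]     ∎)
    where open ≡-Reasoning

  3xℕ≤m : ∀ j → 3 * xℕ j ≤ m
  3xℕ≤m j = ℕ.*-cancelˡ-≤ 2 (subst (_≤ 2 * m) 3zℕ≡2[3xℕ] (3zℕ≤2m j))
    where
    3zℕ≡2[3xℕ] : 3 * zℕ j ≡ 2 * (3 * xℕ j)
    3zℕ≡2[3xℕ] = trans (cong (3 *_) (zℕ≡2xℕ j)) (trans (sym (ℕ.*-assoc 3 2 (xℕ j))) (ℕ.*-assoc 2 3 (xℕ j)))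

OnExtremeCycle : ℕ → ℚ → Set
OnExtremeCycle m y = Σ ℕ λ s → Σ (ExtremeCycle m s) λ C → ∃ λ k → ExtremeCycle.x C k ≡ y

onExtremeCycle⇒natural : ∀ {m y} → OnExtremeCycle m y → ∃ λ b → y ≡ ℚ[ b ]
onExtremeCycle⇒natural (s , C , k , xk≡y) = xℕ k , trans (sym xk≡y) (x≡ℚ[xℕ] k)
  where open ExtremeCycleArithmetic C

onExtremeCycle⇒3b<m : ∀ {m} → ¬ (3 ∣ m) → ∀ b → OnExtremeCycle m ℚ[ b ] → 3 * b < m
onExtremeCycle⇒3b<m {m} 3∤m b (s , C , k , xk≡b) =
  ℕ.≤∧≢⇒< 3b≤m λ 3b≡m → 3∤m (divides b (trans (sym 3b≡m) (ℕ.*-comm 3 b)))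
  where
  open ExtremeCycleArithmetic C
  3b≤m : 3 * b ≤ m
  3b≤m = subst (λ c → 3 * c ≤ m) (ℚ[]-injective {xℕ k} {b} (trans (sym (x≡ℚ[xℕ] k)) xk≡b)) (3xℕ≤m k)

onExtremeCycle-predecessor : ∀ {m} b → OnExtremeCycle m ℚ[ b ] →
  ∃₂ λ b′ d → OnExtremeCycle m ℚ[ b′ ] × (d ≡ 0 ⊎ d ≡ m) × 4 * b ≡ b′ + d
onExtremeCycle-predecessor {m} b (s , C , k , xk≡b) =
  xℕ p , lℕ p , (s , C , p , x≡ℚ[xℕ] p) , lℕ-digit p , ℤ.+-injective (trans (ℤ.pos-* 4 b) (τ-fromℤ (+ xℕ p) (+ b) (+ lℕ p) ℚ[b]≡τ))
  where
  open ExtremeCycleArithmetic C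
  p = pred k
  ℚ[b]≡τ : ℚ[ b ] ≡ τ ℚ[ lℕ p ] ℚ[ xℕ p ]
  ℚ[b]≡τ = trans (sym xk≡b) (trans (x≡τ[pred] k) (cong₂ τ (l≡ℚ[lℕ] p) (x≡ℚ[xℕ] p)))

inNonTrivial⇒onExtremeCycle : ∀ {m y} → InNonTrivialExtremeCycle m y → OnExtremeCycle m y
inNonTrivial⇒onExtremeCycle (s , C , _ , on-C) = s , C , on-C

length-cartesianProductWith : ∀ {A B C : Set} (f : A → B → C) xs ys →
  length (cartesianProductWith f xs ys) ≡ length xs * length ys
length-cartesianProductWith f []       ys = refl
length-cartesianProductWith f (x ∷ xs) ys = begin
  length (map (f x) ys ++ cartesianProductWith f xs ys)        ≡⟨ length-++ (map (f x) ys) ⟩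
  length (map (f x) ys) + length (cartesianProductWith f xs ys) ≡⟨ cong₂ _+_ (length-map (f x) ys) (length-cartesianProductWith f xs ys) ⟩
  length ys + length xs * length ys                              ∎
  where open ≡-Reasoning

Unique-⊆⇒length≤ : ∀ {A : Set} {xs ys : List A} → Unique xs → xs ⊆ ys → length xs ≤ length ys
Unique-⊆⇒length≤ {xs = []}     _               _    = z≤n
Unique-⊆⇒length≤ {xs = x ∷ xs} (x∉xs ∷ unique) x∷xs⊆ys with ∈-∃++ (x∷xs⊆ys (here refl))
... | us , vs , refl = begin
  suc (length xs)              ≤⟨ s≤s (Unique-⊆⇒length≤ unique xs⊆us++vs) ⟩
  suc (length (us ++ vs))      ≡⟨ cong suc (length-++ us) ⟩
  suc (length us + length vs)  ≡⟨ ℕ.+-suc (length us) (length vs) ⟨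
  length us + length (x ∷ vs)  ≡⟨ length-++ us ⟨
  length (us ++ x ∷ vs)        ∎
  where
  open ℕ.≤-Reasoning
  xs⊆us++vs : xs ⊆ us ++ vs
  xs⊆us++vs {y} y∈xs with ∈-++⁻ us (x∷xs⊆ys (there y∈xs))
  ... | inj₁ y∈us         = ∈-++⁺ˡ y∈us
  ... | inj₂ (here refl)  = ⊥-elim (All.lookup x∉xs y∈xs refl)
  ... | inj₂ (there y∈vs) = ∈-++⁺ʳ us y∈vs

All-map-preimage : ∀ {A B : Set} {P : B → Set} (f : A → B) → (∀ {y} → P y → ∃ λ a → y ≡ f a) →
                   ∀ {ys} → All P ys → ∃ λ as → ys ≡ map f as
All-map-preimage f f⁻ All.[]         = [] , refl
All-map-preimage f f⁻ (py All.∷ pys) with f⁻ py | All-map-preimage f f⁻ pys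
... | a , refl | as , refl = a ∷ as , refl

ceiling-multiple : ∀ {K} → 0 < K → ∀ a → ∃ λ q → a ≤ K * q × K * q < a + K
ceiling-multiple {K} 0<K zero = 0 , z≤n , subst (_< K) (sym (ℕ.*-zeroʳ K)) 0<K
ceiling-multiple {K} 0<K (suc a) with ceiling-multiple 0<K a
... | q , a≤Kq , Kq<a+K with ℕ.m≤n⇒m<n∨m≡n a≤Kq
...   | inj₁ a<Kq  = q , a<Kq , ℕ.<-trans Kq<a+K (ℕ.n<1+n (a + K))
...   | inj₂ refl = suc q , subst (suc a ≤_) K+a≡K*[1+q] (ℕ.+-monoˡ-≤ a 0<K)
                          , subst (_< suc a + K) K+a≡K*[1+q] (s≤s (ℕ.≤-reflexive (ℕ.+-comm K a)))
  where K+a≡K*[1+q] = sym (ℕ.*-suc K q)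

multiples-in-window : ∀ {K a q b C} → a ≤ K * q → K * q < a + K → a ≤ K * b → K * b < a + K * C →
                      ∃ λ i → i < C × q + i ≡ b
multiples-in-window {K} {a} {q} {b} {C} a≤Kq Kq<a+K a≤Kb Kb<a+KC =
  b ∸ q , subst (b ∸ q <_) (ℕ.m+n∸m≡n q C) (ℕ.∸-monoˡ-< b<q+C q≤b) , ℕ.m+[n∸m]≡n q≤b
  where
  open ℕ.≤-Reasoning
  q≤b : q ≤ b
  q≤b = ℕ.≤-pred (ℕ.*-cancelˡ-< K q (suc b) (begin-strict
    K * q        <⟨ Kq<a+K ⟩
    a + K        ≤⟨ ℕ.+-monoˡ-≤ K a≤Kb ⟩
    K * b + K    ≡⟨ ℕ.+-comm (K * b) K ⟩
    K + K * b    ≡⟨ ℕ.*-suc K b ⟨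
    K * suc b    ∎))
  b<q+C : b < q + C
  b<q+C = ℕ.*-cancelˡ-< K b (q + C) (begin-strict
    K * b          <⟨ Kb<a+KC ⟩
    a + K * C      ≤⟨ ℕ.+-monoˡ-≤ (K * C) a≤Kq ⟩
    K * q + K * C  ≡⟨ ℕ.*-distribˡ-+ K q C ⟨
    K * (q + C)    ∎)

3*4^n≢0 : ∀ n → ℕ.NonZero (3 * 4 ^ n)
3*4^n≢0 n = ℕ.m*n≢0 3 (4 ^ n) {{_}} {{ℕ.m^n≢0 4 n}}

digitSums : ℕ → ℕ → List ℕ
digitSums m zero    = [ 0 ]
digitSums m (suc k) = digitSums m k ++ map (_+ 4 ^ k * m) (digitSums m k)

length-digitSums : ∀ m k → length (digitSums m k) ≡ 2 ^ k
length-digitSums m zero    = refl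
length-digitSums m (suc k) = begin
  length (D ++ map (_+ 4 ^ k * m) D)          ≡⟨ length-++ D ⟩
  length D + length (map (_+ 4 ^ k * m) D)    ≡⟨ cong (_+_ (length D)) (length-map _ D) ⟩
  length D + length D                         ≡⟨ cong₂ _+_ (length-digitSums m k) (length-digitSums m k) ⟩
  2 ^ k + 2 ^ k                               ≡⟨ cong (_+_ (2 ^ k)) (ℕ.+-identityʳ (2 ^ k)) ⟨
  2 ^ suc k                                   ∎
  where
  open ≡-Reasoning
  D = digitSums m k

+4^k*digit∈digitSums : ∀ {m k d l} → d ∈ digitSums m k → l ≡ 0 ⊎ l ≡ m → d + 4 ^ k * l ∈ digitSums m (suc k)
+4^k*digit∈digitSums {m} {k} {d} d∈ (inj₁ refl) =
  subst (_∈ digitSums m (suc k)) (sym (trans (cong (_+_ d) (ℕ.*-zeroʳ (4 ^ k))) (ℕ.+-identityʳ d))) (∈-++⁺ˡ d∈)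
+4^k*digit∈digitSums {m} {k} d∈ (inj₂ refl) = ∈-++⁺ʳ (digitSums m k) (∈-map⁺ (_+ 4 ^ k * m) d∈)

module BackwardClosed (m : ℕ) (P : ℕ → Set)
  (P-predecessor : ∀ b → P b → ∃₂ λ b′ l → P b′ × (l ≡ 0 ⊎ l ≡ m) × 4 * b ≡ b′ + l) where

  4^k*b≡c+d : ∀ k b → P b → ∃₂ λ c d → P c × d ∈ digitSums m k × 4 ^ k * b ≡ c + d
  4^k*b≡c+d zero b Pb = b , 0 , Pb , here refl , trans (ℕ.*-identityˡ b) (sym (ℕ.+-identityʳ b))
  4^k*b≡c+d (suc k) b Pb with P-predecessor b Pb
  ... | b′ , l , Pb′ , l-digit , 4b≡b′+l with 4^k*b≡c+d k b′ Pb′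
  ...   | c , d , Pc , d∈ , 4^kb′≡c+d = c , d + 4 ^ k * l , Pc , +4^k*digit∈digitSums {k = k} d∈ l-digit , (begin
    4 * 4 ^ k * b           ≡⟨ cong (_* b) (ℕ.*-comm 4 (4 ^ k)) ⟩
    4 ^ k * 4 * b           ≡⟨ ℕ.*-assoc (4 ^ k) 4 b ⟩
    4 ^ k * (4 * b)         ≡⟨ cong (4 ^ k *_) 4b≡b′+l ⟩
    4 ^ k * (b′ + l)        ≡⟨ ℕ.*-distribˡ-+ (4 ^ k) b′ l ⟩
    4 ^ k * b′ + 4 ^ k * l  ≡⟨ cong (_+ 4 ^ k * l) 4^kb′≡c+d ⟩
    c + d + 4 ^ k * l       ≡⟨ ℕ.+-assoc c d (4 ^ k * l) ⟩
    c + (d + 4 ^ k * l)     ∎)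
    where open ≡-Reasoning

  length≤2^n*C : (∀ b → P b → 3 * b < m) → ∀ n C → m ≤ 3 * 4 ^ n * C →
                 ∀ {bs} → Unique bs → All P bs → length bs ≤ 2 ^ n * C
  length≤2^n*C bounded n C m≤KC {bs} unique all-P = begin
    length bs                                ≤⟨ Unique-⊆⇒length≤ unique (λ b∈ → P⊆candidates _ (All.lookup all-P b∈)) ⟩
    length candidates                        ≡⟨ length-cartesianProductWith candidate (digitSums m n) (upTo C) ⟩
    length (digitSums m n) * length (upTo C) ≡⟨ cong₂ _*_ (length-digitSums m n) (length-upTo C) ⟩
    2 ^ n * C                                ∎
    where
    open ℕ.≤-Reasoning
    K = 3 * 4 ^ n
    0<K : 0 < K
    0<K = ℕ.>-nonZero⁻¹ K {{3*4^n≢0 n}}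
    -- candidate d i = ⌈3d/K⌉ + i
    candidate : ℕ → ℕ → ℕ
    candidate d i = proj₁ (ceiling-multiple 0<K (3 * d)) + i
    candidates : List ℕ
    candidates = cartesianProductWith candidate (digitSums m n) (upTo C)
    window : ∀ {b c d} → 4 ^ n * b ≡ c + d → 3 * c < m → ∃ λ i → i < C × candidate d i ≡ b
    window {b} {c} {d} 4^nb≡c+d 3c<m with ceiling-multiple 0<K (3 * d)
    ... | q , 3d≤Kq , Kq<3d+K = multiples-in-window 3d≤Kq Kq<3d+K 3d≤Kb Kb<3d+KC
      where
      Kb≡3d+3c : K * b ≡ 3 * d + 3 * c
      Kb≡3d+3c = begin-equality
        3 * 4 ^ n * b     ≡⟨ ℕ.*-assoc 3 (4 ^ n) b ⟩
        3 * (4 ^ n * b)   ≡⟨ cong (3 *_) 4^nb≡c+d ⟩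
        3 * (c + d)       ≡⟨ ℕ.*-distribˡ-+ 3 c d ⟩
        3 * c + 3 * d     ≡⟨ ℕ.+-comm (3 * c) (3 * d) ⟩
        3 * d + 3 * c     ∎
      3d≤Kb : 3 * d ≤ K * b
      3d≤Kb = subst (3 * d ≤_) (sym Kb≡3d+3c) (ℕ.m≤m+n (3 * d) (3 * c))
      Kb<3d+KC : K * b < 3 * d + K * C
      Kb<3d+KC = subst (_< 3 * d + K * C) (sym Kb≡3d+3c) (ℕ.+-monoʳ-< (3 * d) (ℕ.<-≤-trans 3c<m m≤KC))
    P⊆candidates : ∀ b → P b → b ∈ candidates
    P⊆candidates b Pb with 4^k*b≡c+d n b Pb
    ... | c , d , Pc , d∈ , 4^nb≡c+d with window {c = c} {d} 4^nb≡c+d (bounded c Pc)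
    ...   | i , i<C , eq = subst (_∈ candidates) eq (∈-cartesianProductWith⁺ candidate d∈ (∈-upTo⁺ i<C))

onExtremeCycle-length≤ : ∀ {m} → ¬ (3 ∣ m) → ∀ n C → m ≤ 3 * 4 ^ n * C →
  ∀ {ys} → Unique ys → All (OnExtremeCycle m) ys → length ys ≤ 2 ^ n * C
onExtremeCycle-length≤ {m} 3∤m n C m≤KC unique on-cycles
  with All-map-preimage ℚ[_] onExtremeCycle⇒natural on-cycles
... | bs , refl = subst (_≤ 2 ^ n * C) (sym (length-map ℚ[_] bs))
  (length≤2^n*C (onExtremeCycle⇒3b<m 3∤m) n C m≤KC (Unique.map⁻ unique) (All.map⁻ on-cycles))
  where open BackwardClosed m (λ b → OnExtremeCycle m ℚ[ b ]) onExtremeCycle-predecessor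

lemma3p9 : (m : ℕ) → ¬ (2 ∣ m) → ¬ (3 ∣ m) →
    (ys : List ℚ) → Unique ys → All (InNonTrivialExtremeCycle m) ys →
    (n : ℕ) → + length ys ℤ.≤ + (2 ^ n) ℤ.* ⌈ m/3·4^n m n ⌉
lemma3p9 m _ 3∤m ys unique in-cycles n =
  let C , ⌈m/K⌉≡C , m≤KC = ⌈m/K⌉-natural m (3 * 4 ^ n) {{3*4^n≢0 n}} in begin
    + length ys                     ≤⟨ ℤ.+≤+ (onExtremeCycle-length≤ 3∤m n C m≤KC unique on-cycles) ⟩
    + (2 ^ n * C)                   ≡⟨ ℤ.pos-* (2 ^ n) C ⟩
    + (2 ^ n) ℤ.* + C               ≡⟨ cong (+ (2 ^ n) ℤ.*_) ⌈m/K⌉≡C ⟨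
    + (2 ^ n) ℤ.* ⌈ m/3·4^n m n ⌉   ∎
  where
  open ℤ.≤-Reasoning
  on-cycles : All (OnExtremeCycle m) ys
  on-cycles = All.map inNonTrivial⇒onExtremeCycle in-cycles
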